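{- There is a satisfiable HyperLTL sentence that is not satisfied by any set of ultimately periodic traces.
   Context: Fix a finite set $AP$ of atomic propositions. A trace over $AP$ is a map $t:\mathbb{N}\to 2^{AP}$. A trace $t$ is ultimately periodic if $t=t_0\cdot t_1^\omega$ for some nonempty finite words $t_0,t_1$ over $2^{AP}$, i.e., there are $s,p>0$ with $t(n)=t(n+p)$ for all $n\ge s$; a set of traces is ultimately periodic if all its traces are. HyperLTL formulas are given by the grammar $\varphi ::= \exists \pi.\ \varphi \mid \forall \pi.\ \varphi \mid \psi$ and $\psi ::= a_\pi \mid \neg\psi \mid \psi\vee\psi \mid \mathbf{X}\psi \mid \psi\,\mathbf{U}\,\psi$, where $a\in AP$ and $\pi$ ranges over a countable set of trace variables. For a set $T$ of traces and a trace assignment $\Pi$ (a partial map from trace variables to traces), with $\Pi[j]$ denoting the assignment mapping each $\pi$ in the domain of $\Pi$ to the suffix $\Pi(\pi)(j)\Pi(\pi)(j+1)\cdots$: $(T,\Pi)\models a_\pi$ iff $a\in\Pi(\pi)(0)$; negation and disjunction are as usual; $(T,\Pi)\models\mathbf{X}\psi$ iff $(T,\Pi[1])\models\psi$; $(T,\Pi)\models\psi_1\mathbf{U}\psi_2$ iff there is $j\ge 0$ with $(T,\Pi[j])\models\psi_2$ and $(T,\Pi[j'])\models\psi_1$ for all $0\le j'<j$; $(T,\Pi)\models\exists\pi.\varphi$ iff there is $t\in T$ with $(T,\Pi[\pi\mapsto t])\models\varphi$; $(T,\Pi)\models\forall\pi.\varphi$ iff this holds for all $t\in T$. A sentence is a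 formula without free trace variables; $T$ satisfies (is a model of) a sentence $\varphi$ if $(T,\Pi_\emptyset)\models\varphi$ for the empty assignment $\Pi_\emptyset$. A sentence is satisfiable if it has a model. -}

module Defs where

open import Data.Nat using (ℕ; zero; suc; _+_; _<_; _≥_; _>_)
open import Data.Nat.Properties using (_≟_)
open import Data.Fin using (Fin)
open import Data.Bool using (Bool; true)
open import Data.Maybe using (Maybe; just; nothing)
open import Data.Product using (Σ; _×_; ∃; ∃-syntax)
open import Data.Sum using (_⊎_)
open import Data.Empty using (⊥)
open import Data.List using (List; []; _∷_)
open import Data.List.Membership.Propositional using (_∈_)
open import Relation.Nullary using (¬_; yes; no)
open import Relation.Binary.PropositionalEquality using (_≡_)

-- Atomic propositions: AP = Fin n.  A letter of 2^AP is a subset of AP,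
-- represented by its characteristic function.
Letter : ℕ → Set
Letter n = Fin n → Bool

Trace : ℕ → Set
Trace n = ℕ → Letter n

TraceSet : ℕ → Set₁
TraceSet n = Trace n → Set

Var : Set
Var = ℕ

data Body (n : ℕ) : Set where
  atom  : Fin n → Var → Body n
  neg   : Body n → Body n
  or    : Body n → Body n → Body n
  next  : Body n → Body n
  until : Body n → Body n → Body n

data Formula (n : ℕ) : Set where
  exist : Var → Formula n → Formula n
  forAll : Var → Formula n → Formula n
  body   : Body n → Formula n

Assignment : ℕ → Set
Assignment n = Var → Maybe (Trace n)

emptyAssignment : ∀ {n} → Assignment n
emptyAssignment _ = nothing

update : ∀ {n} → Assignment n → Var → Trace n → Assignment n
update Π π t π' with π' ≟ π
... | yes _ = just t
... | no  _ = Π π'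

suffix : ∀ {n} → Trace n → ℕ → Trace n
suffix t j i = t (j + i)

shift : ∀ {n} → Assignment n → ℕ → Assignment n
shift Π j π with Π π
... | just t  = just (suffix t j)
... | nothing = nothing

-- a ∈ Π(π)(0)  (false if π is unassigned; never happens for sentences)
holdsAt : ∀ {n} → Assignment n → Fin n → Var → Set
holdsAt Π a π with Π π
... | just t  = t 0 a ≡ true
... | nothing = ⊥

satBody : ∀ {n} → TraceSet n → Assignment n → Body n → Set
satBody T Π (atom a π)    = holdsAt Π a π
satBody T Π (neg ψ)       = ¬ satBody T Π ψ
satBody T Π (or ψ₁ ψ₂)    = satBody T Π ψ₁ ⊎ satBody T Π ψ₂
satBody T Π (next ψ)      = satBody T (shift Π 1) ψ
satBody T Π (until ψ₁ ψ₂) =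
  ∃[ j ] (satBody T (shift Π j) ψ₂ × (∀ j' → j' < j → satBody T (shift Π j') ψ₁))

sat : ∀ {n} → TraceSet n → Assignment n → Formula n → Set
sat T Π (exist π φ) = ∃[ t ] (T t × sat T (update Π π t) φ)
sat T Π (forAll π φ) = ∀ t → T t → sat T (update Π π t) φ
sat T Π (body ψ)     = satBody T Π ψ

ClosedBody : ∀ {n} → List Var → Body n → Set
ClosedBody bs (atom a π)    = π ∈ bs
ClosedBody bs (neg ψ)       = ClosedBody bs ψ
ClosedBody bs (or ψ₁ ψ₂)    = ClosedBody bs ψ₁ × ClosedBody bs ψ₂
ClosedBody bs (next ψ)      = ClosedBody bs ψ
ClosedBody bs (until ψ₁ ψ₂) = ClosedBody bs ψ₁ × ClosedBody bs ψ₂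

Closed : ∀ {n} → List Var → Formula n → Set
Closed bs (exist π φ) = Closed (π ∷ bs) φ
Closed bs (forAll π φ) = Closed (π ∷ bs) φ
Closed bs (body ψ)     = ClosedBody bs ψ

Sentence : ∀ {n} → Formula n → Set
Sentence φ = Closed [] φ

_⊨_ : ∀ {n} → TraceSet n → Formula n → Set
T ⊨ φ = sat T emptyAssignment φ

Satisfiable : ∀ {n} → Formula n → Set₁
Satisfiable {n} φ = Σ (TraceSet n) (λ T → T ⊨ φ)

UltimatelyPeriodic : ∀ {n} → Trace n → Set
UltimatelyPeriodic t =
  ∃[ s ] ∃[ p ] (s > 0 × p > 0 × (∀ i → i ≥ s → t i ≡ t (i + p)))

UltimatelyPeriodicSet : ∀ {n} → TraceSet n → Set
UltimatelyPeriodicSet T = ∀ t → T t → UltimatelyPeriodic t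

-- Call a position k of a trace marked if the first atomic proposition a holds there.
-- In every model of the sentence ∃τ ∃κ₀ ∀κ ∃κ′. ψ, every i ≥ 2 is the
-- first mark of some trace κ whose second mark is at 2i: κ₀ has its first two marks
-- at 2 and 4, and a trace with first marks i > 0 and j ≥ i + 2 has a successor κ′ with
-- first marks i + 1 and j + 2.  The conjunct gap forbids τ, when marked at the first mark i
-- of some κ, to be marked strictly between i and the second mark of κ, while G F a_τ
-- makes τ marked infinitely often.  If τ were ultimately periodic with period p, it
-- would be marked at some late i and then at i + p < 2i, contradicting the gap.
-- Conversely, τ marked at 0 and at the powers of two, together with the traces marked
-- exactly at i and 2i (i ≥ 2), form a model.

module Submission where

open import Defs
open import Data.Nat using (ℕ; zero; suc; _+_; _^_; _≤_; _<_; _≤′_; ≤′-refl; ≤′-step; z≤n; s≤s)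
open import Data.Nat.Properties
open import Data.Nat.Logarithm using (⌊log₂_⌋; ⌊log₂[2^n]⌋≡n)
open import Data.Product using (Σ; _×_; _,_; proj₁; ∃-syntax)
open import Data.Sum using (_⊎_; inj₁; inj₂; [_,_])
open import Data.Sum.Function.Propositional using (_⊎-⇔_)
open import Data.Maybe using (Maybe; just; nothing)
open import Data.Fin using (Fin) renaming (zero to fzero)
open import Data.Bool using (true)
import Data.Bool.Properties as Bool
open import Data.Empty using (⊥)
open import Data.Unit using (tt)
open import Data.List using ([]; _∷_)
open import Data.List.Membership.DecPropositional _≟_ using (_∈?_)
open import Effect.Monad using (RawMonad)
open import Function using (_∘_)
open import Function.Bundles using (_⇔_; mk⇔; Equivalence)
open import Function.Related.TypeIsomorphisms using (¬-cong-⇔)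
import Function.Properties.Equivalence as ⇔
open import Level using (0ℓ)
open import Relation.Unary using (Decidable)
open import Relation.Nullary using (¬_; Dec; does; yes; no; toSum; contradiction)
open import Relation.Nullary.Negation using (¬¬-Monad; Stable; negated-stable; ¬¬-map)
open import Relation.Nullary.Decidable using (decidable-stable; _×-dec_; _⊎-dec_; toWitness)
open import Relation.Binary.PropositionalEquality using (_≡_; _≢_; refl; sym; cong; subst)
open import Relation.Binary.Definitions using (tri<; tri≈; tri>)

open Equivalence using (to; from)
open RawMonad (¬¬-Monad {0ℓ}) using (_>>=_; pure)

Until : (ℕ → Set) → (ℕ → Set) → ℕ → Set
Until P Q j = ∃[ w ] (j ≤ w × Q w × (∀ x → j ≤ x → x < w → P x))

Until-cong : ∀ {P P′ Q Q′ : ℕ → Set} → (∀ x → P x ⇔ P′ x) → (∀ x → Q x ⇔ Q′ x) →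
             ∀ j → Until P Q j ⇔ Until P′ Q′ j
Until-cong P⇔P′ Q⇔Q′ j = mk⇔
  (λ (w , j≤w , q , p) → w , j≤w , to (Q⇔Q′ w) q , λ x j≤x x<w → to (P⇔P′ x) (p x j≤x x<w))
  (λ (w , j≤w , q , p) → w , j≤w , from (Q⇔Q′ w) q , λ x j≤x x<w → from (P⇔P′ x) (p x j≤x x<w))

Until₀⇔Until : ∀ {P Q : ℕ → Set} → (∃[ k ] (Q k × (∀ k′ → k′ < k → P k′))) ⇔ Until P Q 0
Until₀⇔Until = mk⇔ (λ (k , q , p) → k , z≤n , q , λ x _ → p x)
                   (λ (k , _ , q , p) → k , q , λ x → p x z≤n)

≤⇒≡+ : ∀ {j x} → j ≤ x → ∃[ d ] x ≡ d + j
≤⇒≡+ j≤x = _ , sym (m∸n+n≡m j≤x)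

Until-+ : ∀ {P Q : ℕ → Set} j k → Until (λ x → P (x + j)) (λ x → Q (x + j)) k ⇔ Until P Q (k + j)
Until-+ {P} {Q} j k = mk⇔ shift→ shift←
  where
  shift→ : Until (λ x → P (x + j)) (λ x → Q (x + j)) k → Until P Q (k + j)
  shift→ (w , k≤w , q , p) = w + j , +-monoˡ-≤ j k≤w , q , prefix
    where
    prefix : ∀ x → k + j ≤ x → x < w + j → P x
    prefix x k+j≤x x<w+j with ≤⇒≡+ (≤-trans (m≤n+m j k) k+j≤x)
    ... | d , refl = p d (+-cancelʳ-≤ j k d k+j≤x) (+-cancelʳ-< j d w x<w+j)

  shift← : Until P Q (k + j) → Until (λ x → P (x + j)) (λ x → Q (x + j)) k
  shift← (w , k+j≤w , q , p) with ≤⇒≡+ (≤-trans (m≤n+m j k) k+j≤w)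
  ... | d , refl = d , +-cancelʳ-≤ j k d k+j≤w , q ,
                   λ x k≤x x<d → p (x + j) (+-monoˡ-≤ j k≤x) (+-monoˡ-< j x<d)

Until-at-first : ∀ {P Q M : ℕ → Set} {p m} →
  (∀ k → Q k → ¬ ¬ M k) → (∀ k → P k → ¬ M k) →
  p ≤ m → M m → (∀ k → p ≤ k → k < m → ¬ M k) →
  Until P Q p → Q m × (∀ k → p ≤ k → k < m → P k)
Until-at-first {m = m} Q⇒M P⇒¬M p≤m Mₘ ¬M (w , p≤w , Qw , P<w) with <-cmp w m
... | tri< w<m _ _  = contradiction (¬M w p≤w w<m) (Q⇒M w Qw)
... | tri≈ _ refl _ = Qw , P<w
... | tri> _ _ m<w  = contradiction Mₘ (P⇒¬M m (P<w m p≤m m<w))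

Until-prefix : ∀ {P Q M : ℕ → Set} {p m} →
  (∀ k → Q k → ¬ ¬ M k) → (∀ k → p ≤ k → k < m → ¬ M k) →
  Until P Q p → ∀ k → p ≤ k → k < m → P k
Until-prefix Q⇒M ¬M (w , p≤w , Qw , P<w) k p≤k k<m with k <? w
... | yes k<w = P<w k p≤k k<w
... | no  k≮w = contradiction (¬M w p≤w (≤-<-trans (≮⇒≥ k≮w) k<m)) (Q⇒M w Qw)

<-suc-elim : ∀ {P : ℕ → Set} {j} → (∀ k → k < j → P k) → P j → ∀ k → k < suc j → P k
<-suc-elim P<j Pⱼ k k<1+j with m<1+n⇒m<n∨m≡n k<1+j
... | inj₁ k<j  = P<j k k<j
... | inj₂ refl = Pⱼ

-- Unlike satBody, which shifts the assignment (and shifts of shifts are not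
-- definitionally shifts), satAt evaluates a body at an absolute position.
Holds : ∀ {n} → Maybe (Trace n) → Fin n → ℕ → Set
Holds (just t) a j = t j a ≡ true
Holds nothing  a j = ⊥

satAt : ∀ {n} → Assignment n → ℕ → Body n → Set
satAt Π j (atom a π)    = Holds (Π π) a j
satAt Π j (neg ψ)       = ¬ satAt Π j ψ
satAt Π j (or ψ₁ ψ₂)    = satAt Π j ψ₁ ⊎ satAt Π j ψ₂
satAt Π j (next ψ)      = satAt Π (suc j) ψ
satAt Π j (until ψ₁ ψ₂) = Until (λ x → satAt Π x ψ₁) (λ x → satAt Π x ψ₂) j

satAt-shift : ∀ {n} (ψ : Body n) Π j k → satAt (shift Π j) k ψ ⇔ satAt Π (k + j) ψ
satAt-shift (atom a π) Π j k with Π π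
... | just t rewrite +-comm k j = ⇔.refl
... | nothing = ⇔.refl
satAt-shift (neg ψ)       Π j k = ¬-cong-⇔ (satAt-shift ψ Π j k)
satAt-shift (or ψ₁ ψ₂)    Π j k = satAt-shift ψ₁ Π j k ⊎-⇔ satAt-shift ψ₂ Π j k
satAt-shift (next ψ)      Π j k = satAt-shift ψ Π j (suc k)
satAt-shift (until ψ₁ ψ₂) Π j k =
  ⇔.trans (Until-cong (satAt-shift ψ₁ Π j) (satAt-shift ψ₂ Π j) k) (Until-+ j k)

satBody⇔satAt : ∀ {n} (T : TraceSet n) ψ Π → satBody T Π ψ ⇔ satAt Π 0 ψ
satBody⇔satAt T (atom a π) Π with Π π
... | just t  = ⇔.refl
... | nothing = ⇔.refl
satBody⇔satAt T (neg ψ)       Π = ¬-cong-⇔ (satBody⇔satAt T ψ Π)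
satBody⇔satAt T (or ψ₁ ψ₂)    Π = satBody⇔satAt T ψ₁ Π ⊎-⇔ satBody⇔satAt T ψ₂ Π
satBody⇔satAt T (next ψ)      Π = ⇔.trans (satBody⇔satAt T ψ (shift Π 1)) (satAt-shift ψ Π 1 0)
satBody⇔satAt T (until ψ₁ ψ₂) Π = ⇔.trans Until₀⇔Until (Until-cong (at ψ₁) (at ψ₂) 0)
  where
  at : ∀ ψ k → satBody T (shift Π k) ψ ⇔ satAt Π k ψ
  at ψ k = ⇔.trans (satBody⇔satAt T ψ (shift Π k)) (satAt-shift ψ Π k 0)

closedBody? : ∀ {n} bs (ψ : Body n) → Dec (ClosedBody bs ψ)
closedBody? bs (atom a π)    = π ∈? bs
closedBody? bs (neg ψ)       = closedBody? bs ψ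
closedBody? bs (or ψ₁ ψ₂)    = closedBody? bs ψ₁ ×-dec closedBody? bs ψ₂
closedBody? bs (next ψ)      = closedBody? bs ψ
closedBody? bs (until ψ₁ ψ₂) = closedBody? bs ψ₁ ×-dec closedBody? bs ψ₂

closed? : ∀ {n} bs (φ : Formula n) → Dec (Closed bs φ)
closed? bs (exist π φ)  = closed? (π ∷ bs) φ
closed? bs (forAll π φ) = closed? (π ∷ bs) φ
closed? bs (body ψ)     = closedBody? bs ψ

-- Conjunction is encoded by De Morgan, so a conjunct is only recovered doubly negated;
-- everything concluded from the sentence below is therefore stable or negative.
module _ {A B : Set} where
  ∧-fst : ¬ (¬ A ⊎ ¬ B) → ¬ ¬ A
  ∧-fst h ¬a = h (inj₁ ¬a)

  ∧-snd : ¬ (¬ A ⊎ ¬ B) → ¬ ¬ B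
  ∧-snd h ¬b = h (inj₂ ¬b)

  ∧-intro : A → B → ¬ (¬ A ⊎ ¬ B)
  ∧-intro a b = [ (λ ¬a → ¬a a) , (λ ¬b → ¬b b) ]

2^-not-between : ∀ {a b i k} → 2 ^ a ≡ i → 2 ^ b ≡ k → i < k → k < i + i → ⊥
2^-not-between {a} {b} refl refl lo hi with a <? b
... | no  a≮b = <⇒≱ lo (^-monoʳ-≤ 2 (≮⇒≥ a≮b))
... | yes a<b = <⇒≱ hi (subst (_≤ 2 ^ b) (cong (2 ^ a +_) (+-identityʳ (2 ^ a))) (^-monoʳ-≤ 2 a<b))

n<2^n : ∀ n → n < 2 ^ n
n<2^n zero    = s≤s z≤n
n<2^n (suc n) = +-mono-≤-< (m^n>0 2 n) (≤-trans (n<2^n n) (m≤m+n (2 ^ n) 0))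

double-suc : ∀ i → suc i + suc i ≡ suc (suc (i + i))
double-suc i = cong suc (+-suc i i)

1+n<n+n : ∀ {i} → 2 ≤ i → suc i < i + i
1+n<n+n {i} 2≤i = +-monoˡ-≤ i 2≤i

zeroOrPowerOf2? : Decidable (λ k → k ≡ 0 ⊎ 2 ^ ⌊log₂ k ⌋ ≡ k)
zeroOrPowerOf2? k = (k ≟ 0) ⊎-dec (2 ^ ⌊log₂ k ⌋ ≟ k)

oneOf? : ∀ i j → Decidable (λ k → k ≡ i ⊎ k ≡ j)
oneOf? i j k = (k ≟ i) ⊎-dec (k ≟ j)

τ κ₀ κ κ′ : Var
τ  = 0
κ₀ = 1
κ  = 2
κ′ = 3

module _ {n : ℕ} where

  Marked : Trace (suc n) → ℕ → Set
  Marked x k = x k fzero ≡ true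

  marked? : ∀ x k → Dec (Marked x k)
  marked? x k = x k fzero Bool.≟ true

  MarkedFrom : Trace (suc n) → ℕ → Set
  MarkedFrom x i = ∃[ k ] (i ≤ k × Marked x k)

  NoMarkBetween : Trace (suc n) → ℕ → ℕ → Set
  NoMarkBetween x i j = ∀ k → i < k → k < j → ¬ Marked x k

  record FirstMarks (x : Trace (suc n)) (i j : ℕ) : Set where
    field
      before  : ∀ k → k < i → ¬ Marked x k
      first   : Marked x i
      between : NoMarkBetween x i j
      second  : Marked x j
      ordered : i < j

  open FirstMarks

  FirstMarks-stable : ∀ {x i j} → Stable (FirstMarks x i j)
  FirstMarks-stable {x} {i} {j} ¬¬fm = record
    { before  = λ k k<i → negated-stable (¬¬-map (λ fm → before fm k k<i) ¬¬fm)
    ; first   = decidable-stable (marked? x i) (¬¬-map first ¬¬fm)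
    ; between = λ k i<k k<j → negated-stable (¬¬-map (λ fm → between fm k i<k k<j) ¬¬fm)
    ; second  = decidable-stable (marked? x j) (¬¬-map second ¬¬fm)
    ; ordered = decidable-stable (suc i ≤? j) (¬¬-map ordered ¬¬fm)
    }

  mark : Var → Body (suc n)
  mark = atom fzero

  infixr 6 _∧_
  _∧_ : Body (suc n) → Body (suc n) → Body (suc n)
  ψ₁ ∧ ψ₂ = neg (or (neg ψ₁) (neg ψ₂))

  ⊤ᵇ : Body (suc n)
  ⊤ᵇ = or (mark τ) (neg (mark τ))

  F G : Body (suc n) → Body (suc n)
  F ψ = until ⊤ᵇ ψ
  G ψ = neg (F (neg ψ))

  infinitelyOften initialCounter quiet secondMarks successor advance afterFirst gap ψ : Body (suc n)
  infinitelyOften = G (F (mark τ))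
  initialCounter  = neg (mark κ₀) ∧ next (neg (mark κ₀) ∧ next (mark κ₀ ∧ next (neg (mark κ₀) ∧ next (mark κ₀))))
  quiet           = neg (mark κ) ∧ neg (mark κ′)
  secondMarks     = mark κ ∧ neg (mark κ′) ∧ next (neg (mark κ′) ∧ next (mark κ′))
  successor       = until quiet (mark κ ∧ neg (mark κ′) ∧ next (mark κ′ ∧ next (until quiet secondMarks)))
  -- the disjunct mark κ exempts κ = τ, which is marked at 0, from having a successor
  advance         = or (mark κ) successor
  afterFirst      = or (neg (mark τ)) (next (until (neg (mark τ)) (mark κ)))
  gap             = until (neg (mark κ)) (mark κ ∧ afterFirst)
  ψ               = infinitelyOften ∧ initialCounter ∧ advance ∧ gap

  φ : Formula (suc n)
  φ = exist τ (exist κ₀ (forAll κ (exist κ′ (body ψ))))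

  φ-sentence : Sentence φ
  φ-sentence = toWitness {a? = closed? [] φ} tt

  assign : (t e d d′ : Trace (suc n)) → Assignment (suc n)
  assign t e d d′ = update (update (update (update emptyAssignment τ t) κ₀ e) κ d) κ′ d′

  module Conjuncts (t e d d′ : Trace (suc n)) where
    private
      Π : Assignment (suc n)
      Π = assign t e d d′

      ⊤ᵇ-holds : ∀ k → satAt Π k ⊤ᵇ
      ⊤ᵇ-holds k = toSum (marked? t k)

      quiet⇒¬κ : ∀ {k} → satAt Π k quiet → ¬ Marked d k
      quiet⇒¬κ q = negated-stable (∧-fst q)

      quiet⇒¬κ′ : ∀ {k} → satAt Π k quiet → ¬ Marked d′ k
      quiet⇒¬κ′ q = negated-stable (∧-snd q)

    ψ-conjuncts : satAt Π 0 ψ →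
      ¬ ¬ (satAt Π 0 infinitelyOften × satAt Π 0 initialCounter × satAt Π 0 advance × satAt Π 0 gap)
    ψ-conjuncts h = do
      GF ← ∧-fst h
      h₁ ← ∧-snd h
      init ← ∧-fst h₁
      h₂ ← ∧-snd h₁
      adv ← ∧-fst h₂
      gp ← ∧-snd h₂
      pure (GF , init , adv , gp)

    ψ-intro : satAt Π 0 infinitelyOften → satAt Π 0 initialCounter → satAt Π 0 advance → satAt Π 0 gap →
              satAt Π 0 ψ
    ψ-intro GF init adv gp = ∧-intro GF (∧-intro init (∧-intro adv gp))

    infinitelyOften-sound : satAt Π 0 infinitelyOften → ∀ i → ¬ ¬ MarkedFrom t i
    infinitelyOften-sound GF i ¬from =
      GF (i , z≤n , (λ (k , i≤k , tₖ , _) → ¬from (k , i≤k , tₖ)) , λ k _ _ → ⊤ᵇ-holds k)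

    infinitelyOften-complete : (∀ i → MarkedFrom t i) → satAt Π 0 infinitelyOften
    infinitelyOften-complete from (i , _ , ¬F , _) with from i
    ... | k , i≤k , tₖ = ¬F (k , i≤k , tₖ , λ k _ _ → ⊤ᵇ-holds k)

    initialCounter-sound : satAt Π 0 initialCounter → FirstMarks e 2 4
    initialCounter-sound h = FirstMarks-stable do
      ¬e₀ ← ∧-fst h
      h₁ ← ∧-snd h
      ¬e₁ ← ∧-fst h₁
      h₂ ← ∧-snd h₁
      e₂ ← ∧-fst h₂
      h₃ ← ∧-snd h₂
      ¬e₃ ← ∧-fst h₃
      e₄ ← ∧-snd h₃
      pure (marks-2-4 ¬e₀ ¬e₁ e₂ ¬e₃ e₄)
      where
      marks-2-4 : ¬ Marked e 0 → ¬ Marked e 1 → Marked e 2 → ¬ Marked e 3 → Marked e 4 → FirstMarks e 2 4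
      marks-2-4 ¬e₀ ¬e₁ e₂ ¬e₃ e₄ = record
        { before  = λ { 0 _ → ¬e₀ ; 1 _ → ¬e₁ ; (suc (suc _)) (s≤s (s≤s ())) }
        ; first   = e₂
        ; between = λ { 0 () ; 1 (s≤s ()) ; 2 (s≤s (s≤s ())) ; 3 _ _ → ¬e₃
                      ; (suc (suc (suc (suc _)))) _ (s≤s (s≤s (s≤s (s≤s ())))) }
        ; second  = e₄
        ; ordered = s≤s (s≤s (s≤s z≤n))
        }

    initialCounter-complete : FirstMarks e 2 4 → satAt Π 0 initialCounter
    initialCounter-complete fm =
      ∧-intro (before fm 0 (s≤s z≤n)) (∧-intro (before fm 1 (s≤s (s≤s z≤n)))
        (∧-intro (first fm) (∧-intro (between fm 3 ≤-refl ≤-refl) (second fm))))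

    advance-sound : ∀ {i j} → FirstMarks d i j → 0 < i → suc i < j →
                    satAt Π 0 advance → FirstMarks d′ (suc i) (suc (suc j))
    advance-sound fm 0<i _ (inj₁ d₀) = contradiction d₀ (before fm 0 0<i)
    advance-sound fm _ i+1<j (inj₂ h) = FirstMarks-stable do
      let (at-i , quiet<i) = Until-at-first (λ _ → ∧-fst) (λ _ → quiet⇒¬κ) z≤n (first fm)
                               (λ k _ → before fm k) h
      h₁ ← ∧-snd at-i
      ¬d′ᵢ ← ∧-fst h₁
      h₂ ← ∧-snd h₁
      d′ᵢ₊₁ ← ∧-fst h₂
      u ← ∧-snd h₂
      let (at-j , quiet<j) = Until-at-first (λ _ → ∧-fst) (λ _ → quiet⇒¬κ) i+1<j (second fm)
                               (λ k i+2≤k → between fm k (≤-trans (n≤1+n _) i+2≤k)) u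
      h₃ ← ∧-snd at-j
      ¬d′ⱼ ← ∧-fst h₃
      h₄ ← ∧-snd h₃
      ¬d′ⱼ₊₁ ← ∧-fst h₄
      d′ⱼ₊₂ ← ∧-snd h₄
      pure record
        { before  = <-suc-elim (λ k k<i → quiet⇒¬κ′ (quiet<i k z≤n k<i)) ¬d′ᵢ
        ; first   = d′ᵢ₊₁
        ; between = λ k i+1<k k<j+2 →
            <-suc-elim (<-suc-elim (λ k k<j i+1<k → quiet⇒¬κ′ (quiet<j k i+1<k k<j)) (λ _ → ¬d′ⱼ))
                       (λ _ → ¬d′ⱼ₊₁) k k<j+2 i+1<k
        ; second  = d′ⱼ₊₂
        ; ordered = s≤s (m≤n⇒m≤1+n (ordered fm))
        }

    successor-complete : ∀ {i j} → FirstMarks d i j → FirstMarks d′ (suc i) (suc (suc j)) → suc i < j →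
                         satAt Π 0 successor
    successor-complete {i} {j} fm fm′ i+1<j =
      i , z≤n , ∧-intro (first fm) (∧-intro (before fm′ i ≤-refl) (∧-intro (first fm′) from-i+2)) ,
      λ k _ k<i → ∧-intro (before fm k k<i) (before fm′ k (m<n⇒m<1+n k<i))
      where
      from-i+2 : satAt Π (suc (suc i)) (until quiet secondMarks)
      from-i+2 = j , i+1<j ,
        ∧-intro (second fm) (∧-intro (between fm′ j i+1<j (m<n⇒m<1+n ≤-refl))
          (∧-intro (between fm′ (suc j) (m<n⇒m<1+n i+1<j) ≤-refl) (second fm′))) ,
        λ k i+2≤k k<j → ∧-intro (between fm k (≤-trans (n≤1+n _) i+2≤k) k<j)
                                (between fm′ k i+2≤k (m<n⇒m<1+n (m<n⇒m<1+n k<j)))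

    gap-sound : ∀ {i j} → FirstMarks d i j → Marked t i → satAt Π 0 gap → NoMarkBetween t i j
    gap-sound {i} fm tᵢ h k i<k k<j tₖ = ∧-snd at-i λ
      { (inj₁ ¬tᵢ) → ¬tᵢ tᵢ
      ; (inj₂ u)   → Until-prefix (λ _ → pure) (between fm) u k i<k k<j tₖ }
      where
      at-i : satAt Π i (mark κ ∧ afterFirst)
      at-i = proj₁ (Until-at-first (λ _ → ∧-fst) (λ _ ¬dₖ → ¬dₖ) z≤n (first fm) (λ k _ → before fm k) h)

    gap-complete : ∀ {i j} → FirstMarks d i j → (Marked t i → NoMarkBetween t i j) → satAt Π 0 gap
    gap-complete {i} {j} fm gapᵗ = i , z≤n , ∧-intro (first fm) after-i , λ k _ → before fm k
      where
      after-i : satAt Π i afterFirst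
      after-i with marked? t i
      ... | no ¬tᵢ = inj₁ ¬tᵢ
      ... | yes tᵢ = inj₂ (j , ordered fm , second fm , gapᵗ tᵢ)

  ¬ultimatelyPeriodic : ∀ {t : Trace (suc n)} → (∀ i → ¬ ¬ MarkedFrom t i) →
    (∀ i → 2 ≤ i → Marked t i → NoMarkBetween t i (i + i)) → ¬ UltimatelyPeriodic t
  ¬ultimatelyPeriodic {t} markedLate gaps (s , p , _ , p>0 , periodic) =
    markedLate (2 + (s + p)) λ (k , b≤k , tₖ) →
      gaps k (≤-trans (m≤m+n 2 (s + p)) b≤k) tₖ (k + p) (m<m+n k p>0)
        (+-monoʳ-< k (<-≤-trans (s≤s (≤-trans (m≤n+m p s) (n≤1+n (s + p)))) b≤k))
        (subst (λ l → l fzero ≡ true) (periodic k (≤-trans (≤-trans (m≤m+n s p) (m≤n+m (s + p) 2)) b≤k)) tₖ)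

  module Consequences (T : TraceSet (suc n)) (t e : Trace (suc n)) (e∈T : T e)
    (witness : ∀ d → T d → ∃[ d′ ] (T d′ × satAt (assign t e d d′) 0 ψ)) where

    counters : ∀ {i} → 2 ≤′ i → ∃[ d ] (T d × FirstMarks d i (i + i))
    counters ≤′-refl with witness e e∈T
    ... | d′ , _ , h = e , e∈T , FirstMarks-stable
      (¬¬-map (λ (_ , init , _) → initialCounter-sound init) (ψ-conjuncts h))
      where open Conjuncts t e e d′
    counters {suc i} (≤′-step 2≤′i) with counters 2≤′i
    ... | d , d∈T , fm with witness d d∈T
    ... | d′ , d′∈T , h = d′ , d′∈T , subst (FirstMarks d′ (suc i)) (sym (double-suc i)) (FirstMarks-stable
      (¬¬-map (λ (_ , _ , adv , _) → advance-sound fm (≤-trans (s≤s z≤n) 2≤i) (1+n<n+n 2≤i) adv) (ψ-conjuncts h)))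
      where
      open Conjuncts t e d d′
      2≤i : 2 ≤ i
      2≤i = ≤′⇒≤ 2≤′i

    gaps : ∀ i → 2 ≤ i → Marked t i → NoMarkBetween t i (i + i)
    gaps i 2≤i tᵢ k i<k k<2i with counters (≤⇒≤′ 2≤i)
    ... | d , d∈T , fm with witness d d∈T
    ... | d′ , _ , h = negated-stable
      (¬¬-map (λ (_ , _ , _ , gp) → gap-sound fm tᵢ gp k i<k k<2i) (ψ-conjuncts h))
      where open Conjuncts t e d d′

    markedLate : ∀ i → ¬ ¬ MarkedFrom t i
    markedLate i with witness e e∈T
    ... | d′ , _ , h = ψ-conjuncts h >>= λ (GF , _) → infinitelyOften-sound GF i
      where open Conjuncts t e e d′

  no-periodic-model : (T : TraceSet (suc n)) → UltimatelyPeriodicSet T → ¬ (T ⊨ φ)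
  no-periodic-model T periodic (t , t∈T , e , e∈T , sat) =
    ¬ultimatelyPeriodic markedLate gaps (periodic t t∈T)
    where
    witness : ∀ d → T d → ∃[ d′ ] (T d′ × satAt (assign t e d d′) 0 ψ)
    witness d d∈T with sat d d∈T
    ... | d′ , d′∈T , h = d′ , d′∈T , to (satBody⇔satAt T ψ (assign t e d d′)) h
    open Consequences T t e e∈T witness

  markedAt : ∀ {P : ℕ → Set} → Decidable P → Trace (suc n)
  markedAt P? k _ = does (P? k)

  Marked-markedAt : ∀ {P : ℕ → Set} (P? : Decidable P) k → Marked (markedAt P?) k ⇔ P k
  Marked-markedAt P? k with P? k
  ... | yes p = mk⇔ (λ _ → p) (λ _ → refl)
  ... | no ¬p = mk⇔ (λ ()) (λ p → contradiction p ¬p)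

  sparse : Trace (suc n)
  sparse = markedAt zeroOrPowerOf2?

  counter : ℕ → Trace (suc n)
  counter i = markedAt (oneOf? i (i + i))

  counter-firstMarks : ∀ {i} → 0 < i → FirstMarks (counter i) i (i + i)
  counter-firstMarks {i} 0<i = record
    { before  = λ k k<i → unmarked (<⇒≢ k<i) (<⇒≢ (<-≤-trans k<i (m≤m+n i i)))
    ; first   = from (Marked-markedAt (oneOf? i (i + i)) i) (inj₁ refl)
    ; between = λ k i<k k<2i → unmarked (>⇒≢ i<k) (<⇒≢ k<2i)
    ; second  = from (Marked-markedAt (oneOf? i (i + i)) (i + i)) (inj₂ refl)
    ; ordered = m<m+n i 0<i
    }
    where
    unmarked : ∀ {k} → k ≢ i → k ≢ i + i → ¬ Marked (counter i) k
    unmarked {k} k≢i k≢2i = [ k≢i , k≢2i ] ∘ to (Marked-markedAt (oneOf? i (i + i)) k)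

  sparse-firstMarks : FirstMarks sparse 0 1
  sparse-firstMarks = record
    { before  = λ _ ()
    ; first   = from (Marked-markedAt zeroOrPowerOf2? 0) (inj₁ refl)
    ; between = λ { (suc _) _ (s≤s ()) }
    ; second  = from (Marked-markedAt zeroOrPowerOf2? 1) (inj₂ refl)
    ; ordered = s≤s z≤n
    }

  sparse-infinitelyOften : ∀ i → MarkedFrom sparse i
  sparse-infinitelyOften i = 2 ^ i , <⇒≤ (n<2^n i) ,
    from (Marked-markedAt zeroOrPowerOf2? (2 ^ i)) (inj₂ (cong (2 ^_) (⌊log₂[2^n]⌋≡n i)))

  sparse-gap : ∀ {i} → Marked sparse i → NoMarkBetween sparse i (i + i)
  sparse-gap {i} sᵢ k i<k k<2i sₖ
    with to (Marked-markedAt zeroOrPowerOf2? i) sᵢ | to (Marked-markedAt zeroOrPowerOf2? k) sₖ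
  ... | inj₁ refl | _ = n≮0 k<2i
  ... | inj₂ _ | inj₁ refl = n≮0 i<k
  ... | inj₂ 2^a≡i | inj₂ 2^b≡k = 2^-not-between {⌊log₂ i ⌋} {⌊log₂ k ⌋} 2^a≡i 2^b≡k i<k k<2i

  data Model : Trace (suc n) → Set where
    sparse∈  : Model sparse
    counter∈ : ∀ {i} → 2 ≤ i → Model (counter i)

  model-ψ : ∀ d d′ → satAt (assign sparse (counter 2) d d′) 0 advance → satAt (assign sparse (counter 2) d d′) 0 gap →
            satAt (assign sparse (counter 2) d d′) 0 ψ
  model-ψ d d′ =
    ψ-intro (infinitelyOften-complete sparse-infinitelyOften) (initialCounter-complete (counter-firstMarks (s≤s z≤n)))
    where open Conjuncts sparse (counter 2) d d′

  model-witness : ∀ d → Model d → ∃[ d′ ] (Model d′ × satAt (assign sparse (counter 2) d d′) 0 ψ)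
  model-witness .sparse sparse∈ = sparse , sparse∈ ,
    model-ψ sparse sparse (inj₁ (first sparse-firstMarks))
      (gap-complete sparse-firstMarks (λ _ → between sparse-firstMarks))
    where open Conjuncts sparse (counter 2) sparse sparse
  model-witness .(counter i) (counter∈ {i} 2≤i) = counter (suc i) , counter∈ (m≤n⇒m≤1+n 2≤i) ,
    model-ψ (counter i) (counter (suc i)) (inj₂ (successor-complete fm fm′ (1+n<n+n 2≤i))) (gap-complete fm sparse-gap)
    where
    open Conjuncts sparse (counter 2) (counter i) (counter (suc i))
    fm : FirstMarks (counter i) i (i + i)
    fm = counter-firstMarks (≤-trans (s≤s z≤n) 2≤i)
    fm′ : FirstMarks (counter (suc i)) (suc i) (suc (suc (i + i)))
    fm′ = subst (FirstMarks _ (suc i)) (double-suc i) (counter-firstMarks (s≤s z≤n))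

  model⊨φ : Model ⊨ φ
  model⊨φ = sparse , sparse∈ , counter 2 , counter∈ ≤-refl , λ d d∈M → satisfied d (model-witness d d∈M)
    where
    satisfied : ∀ d → ∃[ d′ ] (Model d′ × satAt (assign sparse (counter 2) d d′) 0 ψ) →
                ∃[ d′ ] (Model d′ × satBody Model (assign sparse (counter 2) d d′) ψ)
    satisfied d (d′ , d′∈M , h) = d′ , d′∈M , from (satBody⇔satAt Model ψ (assign sparse (counter 2) d d′)) h

theorem5 : (n : ℕ) → Σ (Formula (suc n)) (λ φ → Sentence φ × Satisfiable φ × ((T : TraceSet (suc n)) → UltimatelyPeriodicSet T → ¬ (T ⊨ φ)))
theorem5 n = φ , φ-sentence {n} , (Model , model⊨φ) , no-periodic-model
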